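{- For every real $\gamma>0$ the following holds for all sufficiently large integers $n$. If $H$ is a $3$-graph on $n$ vertices which is induced $K_4^-$-free and satisfies $\delta_2(H)\ge (1/6+\gamma)n$, then $H$ contains a matching that covers all but at most $5/\gamma$ vertices of $H$.
   Context: A $3$-graph $H$ has edge set a family of $3$-element subsets of $V(H)$. $K_4^-$ is the unique (up to isomorphism) $3$-graph with $4$ vertices and $3$ edges. $H$ is induced $K_4^-$-free if there is no $4$-set $W\subseteq V(H)$ such that exactly $3$ of the $3$-subsets of $W$ are edges of $H$. For distinct vertices $x,y$, $\deg_H(\{x,y\})$ is the number of vertices $z$ with $\{x,y,z\}\in E(H)$, and $\delta_2(H)$ is the minimum of this over all pairs. A matching is a set of pairwise vertex-disjoint edges.
   Formalization: The parameter γ ranges over the positive rationals instead of the positive reals. -}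

module Defs where

open import Data.Nat using (ℕ; zero; suc; _+_)
open import Data.Bool using (Bool; true; false)
open import Data.Fin using (Fin; _≟_)
open import Data.Fin.Properties using () renaming (_≟_ to _≟F_)
open import Data.List using (List; []; _∷_; length; filter; concatMap; allFin)
open import Data.List.Relation.Unary.All using (All)
open import Data.List.Relation.Unary.Unique.Propositional using (Unique)
open import Data.Product using (_×_; _,_)
open import Relation.Binary.PropositionalEquality using (_≡_; _≢_)
open import Relation.Nullary using (¬_)
open import Relation.Nullary.Decidable using (¬?)
open import Data.Bool using (T?)
import Data.List.Membership.DecPropositional as DecMem

-- A 3-graph on vertex set Fin n: edge x y z says whether {x,y,z} is an edge.
-- It is symmetric in its arguments and only distinct triples can be edges.
record ThreeGraph (n : ℕ) : Set where
  field
    edge   : Fin n → Fin n → Fin n → Bool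
    sym₁₂  : ∀ x y z → edge x y z ≡ edge y x z
    sym₂₃  : ∀ x y z → edge x y z ≡ edge x z y
    nonDeg : ∀ x y → edge x x y ≡ false

open ThreeGraph public

b2n : Bool → ℕ
b2n true  = 1
b2n false = 0

codeg : ∀ {n} → ThreeGraph n → Fin n → Fin n → ℕ
codeg {n} H x y = length (filter (λ z → T? (edge H x y z)) (allFin n))

InducedK4⁻Free : ∀ {n} → ThreeGraph n → Set
InducedK4⁻Free {n} H =
  ∀ (a b c d : Fin n) → a ≢ b → a ≢ c → a ≢ d → b ≢ c → b ≢ d → c ≢ d →
  ¬ (b2n (edge H a b c) + b2n (edge H a b d) + b2n (edge H a c d) + b2n (edge H b c d) ≡ 3)

Triple : ℕ → Set
Triple n = Fin n × Fin n × Fin n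

verts : ∀ {n} → List (Triple n) → List (Fin n)
verts = concatMap (λ { (x , y , z) → x ∷ y ∷ z ∷ [] })

IsMatching : ∀ {n} → ThreeGraph n → List (Triple n) → Set
IsMatching H M = All (λ { (x , y , z) → edge H x y z ≡ true }) M × Unique (verts M)

uncovered : ∀ {n} → List (Triple n) → ℕ
uncovered {n} M = length (filter (λ v → ¬? (v ∈? verts M)) (allFin n))
  where open DecMem (_≟F_ {n}) using (_∈?_)

-- Let M be a matching that can be enlarged neither by an edge on uncovered vertices nor by
-- trading one of its edges abc for two disjoint edges vxy, wx′y′ with v, w ∈ abc and x, y, x′, y′
-- uncovered, and let U be the set of its u uncovered vertices. Since U spans no edge, induced
-- K₄⁻-freeness makes the link of every covered vertex inside U triangle-free, so by Mantel it has
-- at most u²/4 edges. The trades being unavailable, no two vertices of an edge of M have disjoint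
-- link edges in U; hence in each edge of M at most one vertex has a link of more than 2u edges.
-- Double counting, the sum of deg(xy) over pairs xy in U equals the number of link edges inside
-- U, which is at most (n/3)(u²/4 + O(u)), while the codegree condition makes it at least
-- (u choose 2)(1/6 + γ)n. The main terms nu²/12 cancel, leaving γu² = O(u), i.e. u = O(1/γ).

module Submission where

open import Defs
open import Level using (0ℓ)
open import Data.Bool using (Bool; true; false; T?)
open import Data.Bool.Properties using (¬-not) renaming (_≟_ to _≟ᵇ_)
open import Data.Empty using (⊥-elim)
open import Data.Fin using (Fin) renaming (zero to fzero; suc to fsuc)
open import Data.Fin.Properties using (_≟_; any?)
open import Data.List using (List; []; _∷_; length; filter; allFin)
open import Data.List.Properties using (length-filter; length-tabulate; length-removeAt′)
open import Data.List.Relation.Unary.All as All using (All; []; _∷_)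
open import Data.List.Relation.Unary.All.Properties using (─⁺; ¬Any⇒All¬)
open import Data.List.Relation.Unary.AllPairs using ([]; _∷_)
open import Data.List.Relation.Unary.Any using (here; there; _─_)
open import Data.List.Relation.Unary.Unique.Propositional using (Unique)
open import Data.List.Relation.Unary.Unique.Propositional.Properties using (allFin⁺; filter⁺)
open import Data.List.Membership.Propositional using (_∈_; _∉_)
open import Data.List.Membership.Propositional.Properties using (∈-allFin; ∈-filter⁻)
import Data.List.Membership.DecPropositional as DecMembership
open import Data.List.Relation.Binary.Subset.Propositional using (_⊆_)
open import Data.List.Relation.Binary.Subset.Propositional.Properties using (concatMap⁺; ∷⁺ʳ)
import Data.List.Relation.Binary.Permutation.Setoid as Perm
import Data.List.Relation.Binary.Permutation.Setoid.Properties as PermProperties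
open import Data.Nat using (ℕ; zero; suc; _+_; _*_; _≤_; _<_; z≤n; s≤s; z<s; NonZero)
open import Data.Nat.Properties hiding (_≟_)
open import Data.Nat.Tactic.RingSolver using (solve-∀)
open import Data.Product using (∃-syntax; _×_; _,_; proj₁; proj₂)
open import Data.Sum using (_⊎_; inj₁; inj₂; [_,_]′; map₂)
import Data.Sum.Effectful.Left as Sumₗ
open import Algebra.Properties.CommutativeSemigroup +-commutativeSemigroup using (interchange; x∙yz≈y∙xz)
open import Function using (_∘_; id)
open import Relation.Binary.PropositionalEquality
open import Relation.Nullary using (¬_; Dec; yes; no; ¬?)
open import Relation.Nullary.Decidable using (⌊_⌋; _×-dec_)

-- Sums over lists

∑ : ∀ {a} {A : Set a} → List A → (A → ℕ) → ℕ
∑ []       f = 0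
∑ (x ∷ xs) f = f x + ∑ xs f

syntax ∑ L (λ x → e) = ∑[ x ∈ L ] e

module _ {a} {A : Set a} where

  ∑-cong : (L : List A) {f g : A → ℕ} → (∀ {x} → x ∈ L → f x ≡ g x) → ∑ L f ≡ ∑ L g
  ∑-cong []      f≡g = refl
  ∑-cong (x ∷ L) f≡g = cong₂ _+_ (f≡g (here refl)) (∑-cong L (f≡g ∘ there))

  ∑-mono : (L : List A) {f g : A → ℕ} → (∀ {x} → x ∈ L → f x ≤ g x) → ∑ L f ≤ ∑ L g
  ∑-mono []      f≤g = z≤n
  ∑-mono (x ∷ L) f≤g = +-mono-≤ (f≤g (here refl)) (∑-mono L (f≤g ∘ there))

  ∑-distrib-+ : (L : List A) (f g : A → ℕ) → ∑[ x ∈ L ] (f x + g x) ≡ ∑ L f + ∑ L g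
  ∑-distrib-+ []      f g = refl
  ∑-distrib-+ (x ∷ L) f g rewrite ∑-distrib-+ L f g = interchange (f x) (g x) (∑ L f) (∑ L g)

  *-distribˡ-∑ : (k : ℕ) (L : List A) (f : A → ℕ) → k * ∑ L f ≡ ∑[ x ∈ L ] (k * f x)
  *-distribˡ-∑ k []      f = *-zeroʳ k
  *-distribˡ-∑ k (x ∷ L) f = trans (*-distribˡ-+ k (f x) (∑ L f)) (cong (k * f x +_) (*-distribˡ-∑ k L f))

  ∑-const : (L : List A) (k : ℕ) → ∑[ x ∈ L ] k ≡ length L * k
  ∑-const []      k = refl
  ∑-const (x ∷ L) k = cong (k +_) (∑-const L k)

  ∑>0⇒∃>0 : (L : List A) (f : A → ℕ) → 0 < ∑ L f → ∃[ x ] (x ∈ L × 0 < f x)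
  ∑>0⇒∃>0 (x ∷ L) f pos with f x in fx
  ... | suc _ = x , here refl , subst (0 <_) (sym fx) z<s
  ... | zero  with ∑>0⇒∃>0 L f pos
  ...   | y , y∈L , fy>0 = y , there y∈L , fy>0

  ∑∑-separable : (L : List A) (f : A → ℕ) →
                 ∑[ x ∈ L ] ∑[ y ∈ L ] (f x + f y) ≡ 2 * (length L * ∑ L f)
  ∑∑-separable L f = begin
    ∑[ x ∈ L ] ∑[ y ∈ L ] (f x + f y)        ≡⟨ ∑-cong L (λ {x} _ → ∑-distrib-+ L (λ _ → f x) f) ⟩
    ∑[ x ∈ L ] (∑[ y ∈ L ] f x + ∑ L f)      ≡⟨ ∑-distrib-+ L (λ x → ∑[ y ∈ L ] f x) (λ _ → ∑ L f) ⟩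
    ∑[ x ∈ L ] ∑[ y ∈ L ] f x + ∑[ x ∈ L ] ∑ L f
      ≡⟨ cong₂ _+_ (trans (∑-cong L (λ {x} _ → ∑-const L (f x))) (sym (*-distribˡ-∑ (length L) L f)))
                   (∑-const L (∑ L f)) ⟩
    length L * ∑ L f + length L * ∑ L f      ≡⟨ cong (length L * ∑ L f +_) (sym (+-identityʳ _)) ⟩
    2 * (length L * ∑ L f)                   ∎
    where open ≡-Reasoning

module _ {a b} {A : Set a} {B : Set b} where

  ∑-comm : (L : List A) (K : List B) (f : A → B → ℕ) →
           ∑[ x ∈ L ] ∑[ y ∈ K ] f x y ≡ ∑[ y ∈ K ] ∑[ x ∈ L ] f x y
  ∑-comm []      K f = sym (trans (∑-const K 0) (*-zeroʳ (length K)))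
  ∑-comm (x ∷ L) K f rewrite ∑-comm L K f = sym (∑-distrib-+ K (f x) (λ y → ∑[ x′ ∈ L ] f x′ y))

  ∑*∑ : (L : List A) (K : List B) (f : A → ℕ) (g : B → ℕ) →
        ∑ L f * ∑ K g ≡ ∑[ x ∈ L ] ∑[ y ∈ K ] (f x * g y)
  ∑*∑ []      K f g = refl
  ∑*∑ (x ∷ L) K f g = begin
    (f x + ∑ L f) * ∑ K g                  ≡⟨ *-distribʳ-+ (∑ K g) (f x) (∑ L f) ⟩
    f x * ∑ K g + ∑ L f * ∑ K g            ≡⟨ cong₂ _+_ (*-distribˡ-∑ (f x) K g) (∑*∑ L K f g) ⟩
    ∑[ y ∈ K ] (f x * g y) + ∑[ x′ ∈ L ] ∑[ y ∈ K ] (f x′ * g y) ∎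
    where open ≡-Reasoning

b2n≤1 : ∀ b → b2n b ≤ 1
b2n≤1 true  = s≤s z≤n
b2n≤1 false = z≤n

b2n>0⇒≡true : ∀ {b} → 0 < b2n b → b ≡ true
b2n>0⇒≡true {true} _ = refl

b2n⌊⌋>0⇒witness : ∀ {p} {P : Set p} (P? : Dec P) → 0 < b2n ⌊ P? ⌋ → P
b2n⌊⌋>0⇒witness (yes p) _ = p

module _ {a} {A : Set a} where

  ∑-─ : (K : List A) {x : A} (p : x ∈ K) (f : A → ℕ) → ∑ K f ≡ f x + ∑ (K ─ p) f
  ∑-─ (y ∷ K) (here refl) f = refl
  ∑-─ (y ∷ K) (there p)   f = trans (cong (f y +_) (∑-─ K p f)) (x∙yz≈y∙xz (f y) (f _) (∑ (K ─ p) f))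

  ∈-─ : ∀ {x y} {K : List A} (p : x ∈ K) → y ∈ K → y ≢ x → y ∈ (K ─ p)
  ∈-─ (here refl) (here refl) y≢x = ⊥-elim (y≢x refl)
  ∈-─ (here refl) (there y∈K) _   = y∈K
  ∈-─ (there p)   (here refl) _   = here refl
  ∈-─ (there p)   (there y∈K) y≢x = there (∈-─ p y∈K y≢x)

  ∑-mono-⊆ : {L K : List A} {f : A → ℕ} → Unique L →
             (∀ {x} → x ∈ L → 0 < f x → x ∈ K) → ∑ L f ≤ ∑ K f
  ∑-mono-⊆ {[]}    _          _    = z≤n
  ∑-mono-⊆ {x ∷ L} {K} {f} (x≢L ∷ uL) supp with f x in fx
  ... | zero  = ∑-mono-⊆ uL (supp ∘ there)
  ... | suc k = begin
    suc k + ∑ L f          ≤⟨ +-monoʳ-≤ (suc k) (∑-mono-⊆ uL supp-─) ⟩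
    suc k + ∑ (K ─ x∈K) f  ≡⟨ cong (_+ ∑ (K ─ x∈K) f) (sym fx) ⟩
    f x + ∑ (K ─ x∈K) f    ≡⟨ sym (∑-─ K x∈K f) ⟩
    ∑ K f                  ∎
    where
    open ≤-Reasoning
    x∈K : x ∈ K
    x∈K = supp (here refl) (subst (0 <_) (sym fx) z<s)
    supp-─ : ∀ {y} → y ∈ L → 0 < f y → y ∈ (K ─ x∈K)
    supp-─ y∈L fy>0 = ∈-─ x∈K (supp (there y∈L) fy>0) (≢-sym (All.lookup x≢L y∈L))

  ∑-≤-except : {L : List A} {f g : A → ℕ} (x : A) → Unique L →
               (∀ {y} → y ∈ L → f y ≤ g y ⊎ y ≡ x) → ∑ L f ≤ ∑ L g + f x
  ∑-≤-except {[]}    x _ _ = z≤n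
  ∑-≤-except {y ∷ L} {f} {g} x (y≢L ∷ uL) h with h (here refl)
  ... | inj₁ fy≤gy = ≤-trans (+-mono-≤ fy≤gy (∑-≤-except x uL (h ∘ there)))
                             (≤-reflexive (sym (+-assoc (g y) (∑ L g) (f x))))
  ... | inj₂ refl  = begin
    f y + ∑ L f        ≤⟨ +-monoʳ-≤ (f y) (∑-mono L away-from-y) ⟩
    f y + ∑ L g        ≡⟨ +-comm (f y) (∑ L g) ⟩
    ∑ L g + f y        ≤⟨ +-monoˡ-≤ (f y) (m≤n+m (∑ L g) (g y)) ⟩
    g y + ∑ L g + f y  ∎
    where
    open ≤-Reasoning
    away-from-y : ∀ {z} → z ∈ L → f z ≤ g z
    away-from-y z∈L with h (there z∈L)
    ... | inj₁ fz≤gz = fz≤gz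
    ... | inj₂ refl  = ⊥-elim (All.lookup y≢L z∈L refl)

  ∑-indicator≤ : ∀ {p} {P : A → Set p} (P? : ∀ x → Dec (P x)) {L K : List A} → Unique L →
                 (∀ {x} → P x → x ∈ K) → ∑[ x ∈ L ] b2n ⌊ P? x ⌋ ≤ length K
  ∑-indicator≤ P? {L} {K} uL P⊆K = begin
    ∑[ x ∈ L ] b2n ⌊ P? x ⌋  ≤⟨ ∑-mono-⊆ uL (λ {x} _ pos → P⊆K (b2n⌊⌋>0⇒witness (P? x) pos)) ⟩
    ∑[ x ∈ K ] b2n ⌊ P? x ⌋  ≤⟨ ∑-mono K (λ {x} _ → b2n≤1 ⌊ P? x ⌋) ⟩
    ∑[ x ∈ K ] 1             ≡⟨ trans (∑-const K 1) (*-identityʳ (length K)) ⟩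
    length K                 ∎
    where open ≤-Reasoning

length-unique≤ : ∀ {n} {L : List (Fin n)} → Unique L → length L ≤ n
length-unique≤ {n} {L} uL = begin
  length L                ≡⟨ sym (trans (∑-const L 1) (*-identityʳ (length L))) ⟩
  ∑[ x ∈ L ] 1            ≤⟨ ∑-mono-⊆ uL (λ {x} _ _ → ∈-allFin x) ⟩
  ∑[ x ∈ allFin n ] 1     ≡⟨ trans (∑-const (allFin n) 1) (trans (*-identityʳ _) (length-tabulate id)) ⟩
  n                       ∎
  where open ≤-Reasoning

∑∑-lower-bound : ∀ {n} {L : List (Fin n)} {k} (c : Fin n → Fin n → ℕ) → Unique L →
                 (∀ x y → x ≢ y → k ≤ c x y) →
                 length L * (length L * k) ≤ ∑[ x ∈ L ] ∑[ y ∈ L ] c x y + length L * k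
∑∑-lower-bound {L = L} {k} c uL off-diagonal = begin
  length L * (length L * k)            ≡⟨ sym (trans (∑-cong L (λ _ → ∑-const L k)) (∑-const L (length L * k))) ⟩
  ∑[ x ∈ L ] ∑[ y ∈ L ] k              ≤⟨ ∑-mono L (λ {x} _ → ∑-≤-except x uL (diagonal-or-bounded x)) ⟩
  ∑[ x ∈ L ] (∑[ y ∈ L ] c x y + k)    ≡⟨ trans (∑-distrib-+ L _ (λ _ → k)) (cong (_ +_) (∑-const L k)) ⟩
  ∑[ x ∈ L ] ∑[ y ∈ L ] c x y + length L * k ∎
  where
  open ≤-Reasoning
  diagonal-or-bounded : ∀ x {y} → y ∈ L → k ≤ c x y ⊎ y ≡ x
  diagonal-or-bounded x {y} _ with y ≟ x
  ... | yes y≡x = inj₂ y≡x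
  ... | no  y≢x = inj₁ (off-diagonal x y (≢-sym y≢x))

length-filter-T? : ∀ {a} {A : Set a} (L : List A) (f : A → Bool) →
                   length (filter (λ z → T? (f z)) L) ≡ ∑[ z ∈ L ] b2n (f z)
length-filter-T? []      f = refl
length-filter-T? (x ∷ L) f with f x
... | true  = cong suc (length-filter-T? L f)
... | false = length-filter-T? L f

-- Mantel's theorem

2mn≤m²+n² : ∀ m n → 2 * (m * n) ≤ m * m + n * n
2mn≤m²+n² m n = [ ordered , swapped ]′ (≤-total m n)
  where
  ordered : ∀ {m n} → m ≤ n → 2 * (m * n) ≤ m * m + n * n
  ordered {m} m≤n with k , refl ← m≤n⇒∃[o]m+o≡n m≤n =
    subst (2 * (m * (m + k)) ≤_) (expand m k) (m≤m+n _ (k * k))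
    where
    expand : ∀ m k → 2 * (m * (m + k)) + k * k ≡ m * m + (m + k) * (m + k)
    expand = solve-∀
  swapped : n ≤ m → 2 * (m * n) ≤ m * m + n * n
  swapped n≤m = subst₂ _≤_ (cong (2 *_) (*-comm n m)) (+-comm (n * n) (m * m)) (ordered n≤m)

module _ {a} {A : Set a} where

  cauchy-schwarz : (L : List A) (f : A → ℕ) → ∑ L f * ∑ L f ≤ length L * ∑[ x ∈ L ] (f x * f x)
  cauchy-schwarz L f = *-cancelˡ-≤ 2 (begin
    2 * (∑ L f * ∑ L f)                           ≡⟨ cong (2 *_) (∑*∑ L L f f) ⟩
    2 * ∑[ x ∈ L ] ∑[ y ∈ L ] (f x * f y)          ≡⟨ *-distribˡ-∑ 2 L _ ⟩
    ∑[ x ∈ L ] (2 * ∑[ y ∈ L ] (f x * f y))        ≡⟨ ∑-cong L (λ {x} _ → *-distribˡ-∑ 2 L (λ y → f x * f y)) ⟩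
    ∑[ x ∈ L ] ∑[ y ∈ L ] (2 * (f x * f y))        ≤⟨ ∑-mono L (λ {x} _ → ∑-mono L (λ {y} _ → 2mn≤m²+n² (f x) (f y))) ⟩
    ∑[ x ∈ L ] ∑[ y ∈ L ] (f x * f x + f y * f y)  ≡⟨ ∑∑-separable L (λ x → f x * f x) ⟩
    2 * (length L * ∑[ x ∈ L ] (f x * f x))       ∎)
    where open ≤-Reasoning

  TriangleFree : List A → (A → A → ℕ) → Set a
  TriangleFree L g = ∀ {x y z} → x ∈ L → y ∈ L → z ∈ L → 0 < g x y → g x z + g y z ≤ 1

  mantel : (L : List A) (g : A → A → ℕ) → (∀ x y → g x y ≡ g y x) → TriangleFree L g →
           2 * ∑[ x ∈ L ] ∑[ y ∈ L ] g x y ≤ length L * length L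
  mantel L g g-sym triangle-free = cancel D (begin
    D * (2 * D)    ≡⟨ regroup₁ D ⟩
    2 * (D * D)    ≤⟨ *-monoʳ-≤ 2 (cauchy-schwarz L deg) ⟩
    2 * (u * Q)    ≡⟨ regroup₂ u Q ⟩
    u * (Q + Q)    ≤⟨ *-monoʳ-≤ u 2Q≤uD ⟩
    u * (u * D)    ≡⟨ regroup₃ u D ⟩
    D * (u * u)    ∎)
    where
    open ≤-Reasoning
    u = length L
    deg : A → ℕ
    deg x = ∑ L (g x)
    D = ∑ L deg
    Q = ∑[ x ∈ L ] (deg x * deg x)

    regroup₁ : ∀ d → d * (2 * d) ≡ 2 * (d * d)
    regroup₁ = solve-∀
    regroup₂ : ∀ u q → 2 * (u * q) ≡ u * (q + q)
    regroup₂ = solve-∀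
    regroup₃ : ∀ u d → u * (u * d) ≡ d * (u * u)
    regroup₃ = solve-∀

    cancel : ∀ d → d * (2 * d) ≤ d * (u * u) → 2 * d ≤ u * u
    cancel zero    _ = z≤n
    cancel (suc d) h = *-cancelˡ-≤ (suc d) h

    row : ∀ x → ∑[ y ∈ L ] (g x y * deg x) ≡ deg x * deg x
    row x = trans (∑-cong L (λ {y} _ → *-comm (g x y) (deg x))) (sym (*-distribˡ-∑ (deg x) L (g x)))

    handshake : ∑[ x ∈ L ] ∑[ y ∈ L ] (g x y * (deg x + deg y)) ≡ Q + Q
    handshake = begin-equality
      ∑[ x ∈ L ] ∑[ y ∈ L ] (g x y * (deg x + deg y))
        ≡⟨ ∑-cong L (λ {x} _ → trans (∑-cong L (λ {y} _ → *-distribˡ-+ (g x y) (deg x) (deg y)))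
                                      (∑-distrib-+ L (λ y → g x y * deg x) (λ y → g x y * deg y))) ⟩
      ∑[ x ∈ L ] (∑[ y ∈ L ] (g x y * deg x) + ∑[ y ∈ L ] (g x y * deg y))
        ≡⟨ ∑-distrib-+ L _ _ ⟩
      ∑[ x ∈ L ] ∑[ y ∈ L ] (g x y * deg x) + ∑[ x ∈ L ] ∑[ y ∈ L ] (g x y * deg y)
        ≡⟨ cong₂ _+_ (∑-cong L (λ {x} _ → row x)) (∑-comm L L (λ x y → g x y * deg y)) ⟩
      Q + ∑[ y ∈ L ] ∑[ x ∈ L ] (g x y * deg y)
        ≡⟨ cong (Q +_) (∑-cong L (λ {y} _ → trans (∑-cong L (λ {x} _ → cong (_* deg y) (g-sym x y))) (row y))) ⟩
      Q + Q ∎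

    neighbours : ∀ {x y} → x ∈ L → y ∈ L → g x y * (deg x + deg y) ≤ u * g x y
    neighbours {x} {y} x∈L y∈L with g x y in gxy
    ... | zero  = z≤n
    ... | suc k = ≤-trans (*-monoʳ-≤ (suc k) (begin
      deg x + deg y              ≡⟨ sym (∑-distrib-+ L (g x) (g y)) ⟩
      ∑[ z ∈ L ] (g x z + g y z) ≤⟨ ∑-mono L (λ z∈L → triangle-free x∈L y∈L z∈L (subst (0 <_) (sym gxy) z<s)) ⟩
      ∑[ z ∈ L ] 1               ≡⟨ trans (∑-const L 1) (*-identityʳ u) ⟩
      u                          ∎)) (≤-reflexive (*-comm (suc k) u))

    2Q≤uD : Q + Q ≤ u * D
    2Q≤uD = begin
      Q + Q
        ≡⟨ sym handshake ⟩
      ∑[ x ∈ L ] ∑[ y ∈ L ] (g x y * (deg x + deg y))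
        ≤⟨ ∑-mono L (λ x∈L → ∑-mono L (neighbours x∈L)) ⟩
      ∑[ x ∈ L ] ∑[ y ∈ L ] (u * g x y)
        ≡⟨ sym (trans (*-distribˡ-∑ u L deg) (∑-cong L (λ {x} _ → *-distribˡ-∑ u L (g x)))) ⟩
      u * D ∎

-- Numerical bounds

CrossBounded : ℕ → ℕ → ℕ → Set
CrossBounded K A B = (0 < A → B ≤ K) × (0 < B → A ≤ K)

one-or-all-bounded : ∀ {X K} A B C → 2 * A ≤ X → 2 * B ≤ X → 2 * C ≤ X →
                     CrossBounded K A B → CrossBounded K A C → CrossBounded K B C →
                     2 * (A + B + C) ≤ X ⊎ (A ≤ K × B ≤ K × C ≤ K)
one-or-all-bounded zero    zero    C       _  _  hC _  _  _  = inj₁ hC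
one-or-all-bounded zero    (suc b) zero    _  hB _  _  _  _  =
  inj₁ (≤-trans (≤-reflexive (cong (2 *_) (+-identityʳ (suc b)))) hB)
one-or-all-bounded (suc a) zero    zero    hA _  _  _  _  _  =
  inj₁ (≤-trans (≤-reflexive (cong (2 *_) (trans (+-identityʳ (suc a + 0)) (+-identityʳ (suc a))))) hA)
one-or-all-bounded zero    (suc b) (suc c) _  _  _  _  _  bc = inj₂ (z≤n , proj₂ bc z<s , proj₁ bc z<s)
one-or-all-bounded (suc a) zero    (suc c) _  _  _  _  ac _  = inj₂ (proj₂ ac z<s , z≤n , proj₁ ac z<s)
one-or-all-bounded (suc a) (suc b) zero    _  _  _  ab _  _  = inj₂ (proj₂ ab z<s , proj₁ ab z<s , z≤n)
one-or-all-bounded (suc a) (suc b) (suc c) _  _  _  ab ac _  = inj₂ (proj₂ ab z<s , proj₁ ab z<s , proj₁ ac z<s)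

triple-bound : ∀ {X K} A B C → 2 * A ≤ X → 2 * B ≤ X → 2 * C ≤ X →
               CrossBounded K A B → CrossBounded K A C → CrossBounded K B C →
               2 * (A + B + C) ≤ X + 6 * K
triple-bound {X} {K} A B C hA hB hC ab ac bc =
  [ (λ h → ≤-trans h (m≤m+n X (6 * K))) , all≤ ]′ (one-or-all-bounded A B C hA hB hC ab ac bc)
  where
  all≤ : A ≤ K × B ≤ K × C ≤ K → 2 * (A + B + C) ≤ X + 6 * K
  all≤ (A≤K , B≤K , C≤K) = begin
    2 * (A + B + C)  ≤⟨ *-monoʳ-≤ 2 (+-mono-≤ (+-mono-≤ A≤K B≤K) C≤K) ⟩
    2 * (K + K + K)  ≡⟨ six K ⟩
    6 * K            ≤⟨ m≤n+m (6 * K) X ⟩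
    X + 6 * K        ∎
    where
    open ≤-Reasoning
    six : ∀ k → 2 * (k + k + k) ≡ 6 * k
    six = solve-∀

linear-bound : ∀ {u p q} → 6 * p ≤ 5 * q →
               u * (u * (q + 6 * p)) ≤ q * (u * u + 6 * (4 * u)) + u * (q + 6 * p) → p * u ≤ 5 * q
linear-bound {zero} {p} {q} _ _ = subst (_≤ 5 * q) (sym (*-zeroʳ p)) z≤n
linear-bound {u@(suc _)} {p} {q} 6p≤5q h = *-cancelˡ-≤ 6 (begin
  6 * (p * u)      ≤⟨ +-cancelˡ-≤ (q * u) _ _ cancelled ⟩
  25 * q + 6 * p   ≤⟨ +-monoʳ-≤ (25 * q) 6p≤5q ⟩
  25 * q + 5 * q   ≡⟨ thirty q ⟩
  6 * (5 * q)      ∎)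
  where
  open ≤-Reasoning
  collect : ∀ u q p → q * (u * u + 6 * (4 * u)) + u * (q + 6 * p) ≡ u * (q * u + (25 * q + 6 * p))
  collect = solve-∀
  split : ∀ u q p → u * (q + 6 * p) ≡ q * u + 6 * (p * u)
  split = solve-∀
  thirty : ∀ q → 25 * q + 5 * q ≡ 6 * (5 * q)
  thirty = solve-∀
  cancelled : q * u + 6 * (p * u) ≤ q * u + (25 * q + 6 * p)
  cancelled = begin
    q * u + 6 * (p * u)       ≡⟨ sym (split u q p) ⟩
    u * (q + 6 * p)           ≤⟨ *-cancelˡ-≤ u (≤-trans h (≤-reflexive (collect u q p))) ⟩
    q * u + (25 * q + 6 * p)  ∎

uncovered-bound : ∀ {n m u p q T} .{{_ : NonZero n}} → 6 * p ≤ 5 * q → 3 * m ≤ n →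
                  2 * T ≤ m * (u * u + 6 * (4 * u)) →
                  u * (u * ((q + 6 * p) * n)) ≤ 6 * q * T + u * ((q + 6 * p) * n) → p * u ≤ 5 * q
uncovered-bound {n} {m} {u} {p} {q} {T} 6p≤5q 3m≤n 2T≤mX lower =
  linear-bound {u} {p} {q} 6p≤5q (*-cancelˡ-≤ n (begin
  n * (u * (u * K))           ≡⟨ shuffle₁ n u K ⟩
  u * (u * (K * n))           ≤⟨ lower ⟩
  6 * q * T + u * (K * n)     ≤⟨ +-monoˡ-≤ (u * (K * n)) 6qT≤qnX ⟩
  q * (n * X) + u * (K * n)   ≡⟨ shuffle₂ n u K q X ⟩
  n * (q * X + u * K)         ∎))
  where
  open ≤-Reasoning
  K = q + 6 * p
  X = u * u + 6 * (4 * u)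
  shuffle₁ : ∀ n u k → n * (u * (u * k)) ≡ u * (u * (k * n))
  shuffle₁ = solve-∀
  shuffle₂ : ∀ n u k q x → q * (n * x) + u * (k * n) ≡ n * (q * x + u * k)
  shuffle₂ = solve-∀
  shuffle₃ : ∀ q t → 6 * q * t ≡ 3 * q * (2 * t)
  shuffle₃ = solve-∀
  shuffle₄ : ∀ q m x → 3 * q * (m * x) ≡ q * (3 * m * x)
  shuffle₄ = solve-∀
  6qT≤qnX : 6 * q * T ≤ q * (n * X)
  6qT≤qnX = begin
    6 * q * T        ≡⟨ shuffle₃ q T ⟩
    3 * q * (2 * T)  ≤⟨ *-monoʳ-≤ (3 * q) 2T≤mX ⟩
    3 * q * (m * X)  ≡⟨ shuffle₄ q m X ⟩
    q * (3 * m * X)  ≤⟨ *-monoʳ-≤ q (*-monoˡ-≤ X 3m≤n) ⟩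
    q * (n * X)      ∎

bounded-improvement : ∀ {a q p} {A : Set a} {Q : A → Set q} {P : A → Set p} (size : A → ℕ) (B : ℕ) →
                      (∀ {x} → Q x → size x ≤ B) →
                      (∀ {x} → Q x → (∃[ y ] (Q y × size x < size y)) ⊎ P x) →
                      ∀ {x} → Q x → ∃[ y ] (Q y × P y)
bounded-improvement {Q = Q} {P} size B bounded improve qx = go (suc B) qx (s≤s (m≤m+n B _))
  where
  go : ∀ k {x} → Q x → B < k + size x → ∃[ y ] (Q y × P y)
  go zero    qx B<size = ⊥-elim (<⇒≱ B<size (bounded qx))
  go (suc k) {x} qx B<1+k+size with improve qx
  ... | inj₂ px               = x , qx , px
  ... | inj₁ (y , qy , grows) =
    go k qy (≤-trans B<1+k+size (≤-trans (≤-reflexive (sym (+-suc k (size x)))) (+-monoʳ-≤ k grows)))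

-- Matchings

─⊆ : ∀ {a} {A : Set a} {x : A} {xs} (p : x ∈ xs) → (xs ─ p) ⊆ xs
─⊆ (here _)  = there
─⊆ (there p) = ∷⁺ʳ _ (─⊆ p)

avoids : ∀ {a} {A : Set a} {x y z v : A} {V} → Unique (x ∷ y ∷ z ∷ V) → v ∈ x ∷ y ∷ z ∷ [] → All (v ≢_) V
avoids ((_ ∷ _ ∷ x≢V) ∷ _)  (here refl)               = x≢V
avoids (_ ∷ (_ ∷ y≢V) ∷ _)  (there (here refl))       = y≢V
avoids (_ ∷ _ ∷ z≢V ∷ _)    (there (there (here refl))) = z≢V

module _ {n : ℕ} where

  open Perm (setoid (Fin n)) using (_↭_; ↭-refl; ↭-trans)
  open PermProperties (setoid (Fin n)) using (shifts; ++⁺ˡ; Unique-resp-↭)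

  ∑₃ : (Fin n → ℕ) → Triple n → ℕ
  ∑₃ f (x , y , z) = f x + f y + f z

  ∑-verts : (M : List (Triple n)) (f : Fin n → ℕ) → ∑ (verts M) f ≡ ∑ M (∑₃ f)
  ∑-verts []                f = refl
  ∑-verts ((x , y , z) ∷ M) f = begin
    f x + (f y + (f z + ∑ (verts M) f)) ≡⟨ cong (λ s → f x + (f y + (f z + s))) (∑-verts M f) ⟩
    f x + (f y + (f z + ∑ M (∑₃ f)))    ≡⟨ sym (trans (+-assoc (f x + f y) (f z) _) (+-assoc (f x) (f y) _)) ⟩
    f x + f y + f z + ∑ M (∑₃ f)        ∎
    where open ≡-Reasoning

  length-verts : (M : List (Triple n)) → length (verts M) ≡ 3 * length M
  length-verts []                = refl
  length-verts ((_ , _ , _) ∷ M) = trans (cong (3 +_) (length-verts M)) (sym (*-suc 3 (length M)))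

  verts-∈ : ∀ {M : List (Triple n)} {x y z v} → (x , y , z) ∈ M → v ∈ x ∷ y ∷ z ∷ [] → v ∈ verts M
  verts-∈ {x = x} {y} {z} t∈M = concatMap⁺ {xs = (x , y , z) ∷ []} _ (λ { (here refl) → t∈M ; (there ()) })

  verts-─ : ∀ {M : List (Triple n)} {x y z} (p : (x , y , z) ∈ M) → verts M ↭ x ∷ y ∷ z ∷ verts (M ─ p)
  verts-─ (here refl) = ↭-refl
  verts-─ {(x′ , y′ , z′) ∷ M} {x} {y} {z} (there p) =
    ↭-trans (++⁺ˡ (x′ ∷ y′ ∷ z′ ∷ []) (verts-─ p)) (shifts (x′ ∷ y′ ∷ z′ ∷ []) (x ∷ y ∷ z ∷ []))

  Unique-─ : ∀ {M : List (Triple n)} {x y z} (p : (x , y , z) ∈ M) →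
             Unique (verts M) → Unique (x ∷ y ∷ z ∷ verts (M ─ p))
  Unique-─ p = Unique-resp-↭ (verts-─ p)

module _ {n : ℕ} (H : ThreeGraph n) where

  χ : Fin n → Fin n → Fin n → ℕ
  χ x y z = b2n (edge H x y z)

  χ-rotate : ∀ x y z → χ x y z ≡ χ z x y
  χ-rotate x y z = cong b2n (trans (sym₂₃ H x y z) (sym₁₂ H x z y))

  edge⇒≢₁₂ : ∀ {x y z} → edge H x y z ≡ true → x ≢ y
  edge⇒≢₁₂ {x} {_} {z} e refl with () ← trans (sym e) (nonDeg H x z)

  edge⇒≢₁₃ : ∀ {x y z} → edge H x y z ≡ true → x ≢ z
  edge⇒≢₁₃ {x} {y} e refl with () ← trans (sym e) (trans (sym₂₃ H x y x) (nonDeg H x y))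

  edge⇒≢₂₃ : ∀ {x y z} → edge H x y z ≡ true → y ≢ z
  edge⇒≢₂₃ {x} {y} e refl with () ← trans (sym e) (trans (sym₁₂ H x y y) (trans (sym₂₃ H y x y) (nonDeg H y x)))

  matching-edge : ∀ {M x y z} → IsMatching H M → (x , y , z) ∈ M → edge H x y z ≡ true
  matching-edge (edges , _) t∈M = All.lookup edges t∈M

  IsMatching-∷ : ∀ {M x y z} → IsMatching H M → edge H x y z ≡ true →
                 All (x ≢_) (verts M) → All (y ≢_) (verts M) → All (z ≢_) (verts M) →
                 IsMatching H ((x , y , z) ∷ M)
  IsMatching-∷ (edges , unique) e x≢M y≢M z≢M =
    e ∷ edges , (edge⇒≢₁₂ e ∷ edge⇒≢₁₃ e ∷ x≢M) ∷ (edge⇒≢₂₃ e ∷ y≢M) ∷ z≢M ∷ unique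

  IsMatching-─ : ∀ {M x y z} → IsMatching H M → (p : (x , y , z) ∈ M) → IsMatching H (M ─ p)
  IsMatching-─ (edges , unique) p with _ ∷ _ ∷ _ ∷ unique-─ ← Unique-─ p unique = ─⁺ p edges , unique-─

  3*length≤n : ∀ {M} → IsMatching H M → 3 * length M ≤ n
  3*length≤n {M} (_ , unique) = subst (_≤ n) (length-verts M) (length-unique≤ unique)

  codeg≤n : ∀ x y → codeg H x y ≤ n
  codeg≤n x y =
    ≤-trans (length-filter (λ z → T? (edge H x y z)) (allFin n)) (≤-reflexive (length-tabulate id))

  density≤5/6 : ∀ {p q} .{{_ : NonZero n}} x y →
                (q + 6 * p) * n ≤ 6 * q * codeg H x y → 6 * p ≤ 5 * q
  density≤5/6 {p} {q} x y bound =
    +-cancelˡ-≤ q (6 * p) (5 * q) (*-cancelʳ-≤ (q + 6 * p) (6 * q) n (≤-trans bound (*-monoʳ-≤ (6 * q) (codeg≤n x y))))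

  Augmentable : List (Triple n) → Set
  Augmentable M = ∃[ M′ ] (IsMatching H M′ × length M < length M′)

  module Uncovered (M : List (Triple n)) where

    open DecMembership (_≟_ {n}) using (_∈?_)

    W : List (Fin n)
    W = verts M

    U : List (Fin n)
    U = filter (λ v → ¬? (v ∈? W)) (allFin n)

    u : ℕ
    u = length U

    ∈U⇒∉W : ∀ {x} → x ∈ U → x ∉ W
    ∈U⇒∉W x∈U = proj₂ (∈-filter⁻ (λ v → ¬? (v ∈? W)) {xs = allFin n} x∈U)

    U-unique : Unique U
    U-unique = filter⁺ (λ v → ¬? (v ∈? W)) (allFin⁺ n)

    LinkEdge : Fin n → Fin n → Fin n → Set
    LinkEdge v x y = x ∉ W × y ∉ W × edge H v x y ≡ true

    UncoveredEdge : Set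
    UncoveredEdge = ∃[ x ] ∃[ y ] ∃[ z ] (x ∉ W × LinkEdge x y z)

    DisjointLinks : Fin n → Fin n → Set
    DisjointLinks v w = ∃[ x ] ∃[ y ] ∃[ x′ ] ∃[ y′ ]
      (LinkEdge v x y × LinkEdge w x′ y′ × x ≢ x′ × x ≢ y′ × y ≢ x′ × y ≢ y′)

    DisjointLinks-sym : ∀ {v w} → DisjointLinks v w → DisjointLinks w v
    DisjointLinks-sym (x , y , x′ , y′ , vxy , wx′y′ , x≢x′ , x≢y′ , y≢x′ , y≢y′) =
      x′ , y′ , x , y , wx′y′ , vxy , ≢-sym x≢x′ , ≢-sym y≢x′ , ≢-sym x≢y′ , ≢-sym y≢y′

    linkEdge? : ∀ v x y → Dec (LinkEdge v x y)
    linkEdge? v x y = ¬? (x ∈? W) ×-dec ¬? (y ∈? W) ×-dec edge H v x y ≟ᵇ true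

    uncoveredEdge? : Dec UncoveredEdge
    uncoveredEdge? = any? λ x → any? λ y → any? λ z → ¬? (x ∈? W) ×-dec linkEdge? x y z

    disjointLinks? : ∀ v w → Dec (DisjointLinks v w)
    disjointLinks? v w = any? λ x → any? λ y → any? λ x′ → any? λ y′ →
      linkEdge? v x y ×-dec linkEdge? w x′ y′ ×-dec
      ¬? (x ≟ x′) ×-dec ¬? (x ≟ y′) ×-dec ¬? (y ≟ x′) ×-dec ¬? (y ≟ y′)

    augment-by-edge : IsMatching H M → UncoveredEdge → Augmentable M
    augment-by-edge isM (x , y , z , x∉W , y∉W , z∉W , e) =
      (x , y , z) ∷ M , IsMatching-∷ isM e (¬Any⇒All¬ W x∉W) (¬Any⇒All¬ W y∉W) (¬Any⇒All¬ W z∉W) , ≤-refl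

    augment-by-swap : ∀ {a b c v w} → IsMatching H M → (p : (a , b , c) ∈ M) →
                      v ∈ a ∷ b ∷ c ∷ [] → w ∈ a ∷ b ∷ c ∷ [] → v ≢ w → DisjointLinks v w → Augmentable M
    augment-by-swap {a} {b} {c} {v} {w} isM p v∈t w∈t v≢w
      (x , y , x′ , y′ , (x∉W , y∉W , vxy) , (x′∉W , y′∉W , wx′y′) , x≢x′ , x≢y′ , y≢x′ , y≢y′) =
      (v , x , y) ∷ (w , x′ , y′) ∷ M₀ , matching , ≤-reflexive (cong suc (length-removeAt′ M _))
      where
      M₀ = M ─ p
      t-avoids : ∀ {s} → s ∈ a ∷ b ∷ c ∷ [] → All (s ≢_) (verts M₀)
      t-avoids = avoids (Unique-─ p (proj₂ isM))
      uncovered-avoids : ∀ {s} → s ∉ W → All (s ≢_) (verts M₀)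
      uncovered-avoids s∉W = ¬Any⇒All¬ _ (s∉W ∘ concatMap⁺ _ (─⊆ p))
      covered≢ : ∀ {s r} → s ∈ a ∷ b ∷ c ∷ [] → r ∉ W → s ≢ r
      covered≢ s∈t r∉W refl = r∉W (verts-∈ p s∈t)
      matching : IsMatching H ((v , x , y) ∷ (w , x′ , y′) ∷ M₀)
      matching =
        IsMatching-∷
          (IsMatching-∷ (IsMatching-─ isM p) wx′y′ (t-avoids w∈t) (uncovered-avoids x′∉W) (uncovered-avoids y′∉W))
          vxy
          (v≢w ∷ covered≢ v∈t x′∉W ∷ covered≢ v∈t y′∉W ∷ t-avoids v∈t)
          (≢-sym (covered≢ w∈t x∉W) ∷ x≢x′ ∷ x≢y′ ∷ uncovered-avoids x∉W)
          (≢-sym (covered≢ w∈t y∉W) ∷ y≢x′ ∷ y≢y′ ∷ uncovered-avoids y∉W)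

    -- Ordered pairs, i.e. twice the number of edges of the link of v inside U.
    linkPairs : Fin n → ℕ
    linkPairs v = ∑[ x ∈ U ] ∑[ y ∈ U ] χ v x y

    linkPairs>0⇒LinkEdge : ∀ {v} → 0 < linkPairs v → ∃[ x ] ∃[ y ] LinkEdge v x y
    linkPairs>0⇒LinkEdge {v} pos
      with x , x∈U , pos₁ ← ∑>0⇒∃>0 U _ pos
      with y , y∈U , pos₂ ← ∑>0⇒∃>0 U (χ v x) pos₁
      = x , y , ∈U⇒∉W x∈U , ∈U⇒∉W y∈U , b2n>0⇒≡true pos₂

    linkPairs-mantel : InducedK4⁻Free H → ¬ UncoveredEdge → ∀ {v} → v ∈ W → 2 * linkPairs v ≤ u * u
    linkPairs-mantel k4 no-edge {v} v∈W = mantel U (χ v) (λ x y → cong b2n (sym₂₃ H v x y)) triangle-free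
      where
      v≢ : ∀ {x} → x ∈ U → v ≢ x
      v≢ x∈U refl = ∈U⇒∉W x∈U v∈W
      triangle-free : TriangleFree U (χ v)
      triangle-free {x} {y} {z} x∈U y∈U z∈U vxy>0 with edge H v x z in vxz | edge H v y z in vyz
      ... | false | false = z≤n
      ... | false | true  = ≤-refl
      ... | true  | false = ≤-refl
      ... | true  | true  =
        ⊥-elim (k4 v x y z (v≢ x∈U) (v≢ y∈U) (v≢ z∈U) (edge⇒≢₂₃ vxy) (edge⇒≢₂₃ vxz) (edge⇒≢₂₃ vyz) three-edges)
        where
        vxy : edge H v x y ≡ true
        vxy = b2n>0⇒≡true vxy>0
        xyz : edge H x y z ≡ false
        xyz = ¬-not (λ e → no-edge (x , y , z , ∈U⇒∉W x∈U , ∈U⇒∉W y∈U , ∈U⇒∉W z∈U , e))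
        three-edges : χ v x y + χ v x z + χ v y z + χ x y z ≡ 3
        three-edges = cong₂ _+_ (cong₂ _+_ (cong₂ _+_ (cong b2n vxy) (cong b2n vxz)) (cong b2n vyz)) (cong b2n xyz)

    linkPairs-cross : ∀ {v w x y} → ¬ DisjointLinks v w → LinkEdge v x y → linkPairs w ≤ 4 * u
    linkPairs-cross {v} {w} {x} {y} no-swap vxy = begin
      linkPairs w                             ≤⟨ ∑-mono U (λ x′∈U → ∑-mono U (meets x′∈U)) ⟩
      ∑[ x′ ∈ U ] ∑[ y′ ∈ U ] (I x′ + I y′)   ≡⟨ ∑∑-separable U I ⟩
      2 * (u * ∑ U I)                         ≤⟨ *-monoʳ-≤ 2 (*-monoʳ-≤ u (∑-indicator≤ (_∈? xy) U-unique id)) ⟩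
      2 * (u * 2)                             ≡⟨ four u ⟩
      4 * u                                   ∎
      where
      open ≤-Reasoning
      xy = x ∷ y ∷ []
      I : Fin n → ℕ
      I z = b2n ⌊ z ∈? xy ⌋
      four : ∀ u → 2 * (u * 2) ≡ 4 * u
      four = solve-∀
      meets : ∀ {x′ y′} → x′ ∈ U → y′ ∈ U → χ w x′ y′ ≤ I x′ + I y′
      meets {x′} {y′} x′∈U y′∈U with x′ ∈? xy | y′ ∈? xy | edge H w x′ y′ in wx′y′
      ... | _ | _ | false = z≤n
      ... | yes _ | _ | true = s≤s z≤n
      ... | no _ | yes _ | true = ≤-refl
      ... | no x′∉xy | no y′∉xy | true =
        ⊥-elim (no-swap (x , y , x′ , y′ , vxy , (∈U⇒∉W x′∈U , ∈U⇒∉W y′∈U , wx′y′) ,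
                         (λ { refl → x′∉xy (here refl) }) , (λ { refl → y′∉xy (here refl) }) ,
                         (λ { refl → x′∉xy (there (here refl)) }) , (λ { refl → y′∉xy (there (here refl)) })))

    disjoint-or-cross-bounded : ∀ v w → DisjointLinks v w ⊎ CrossBounded (4 * u) (linkPairs v) (linkPairs w)
    disjoint-or-cross-bounded v w with disjointLinks? v w
    ... | yes swap = inj₁ swap
    ... | no no-swap = inj₂ (cross no-swap , cross (no-swap ∘ DisjointLinks-sym))
      where
      cross : ∀ {v w} → ¬ DisjointLinks v w → 0 < linkPairs v → linkPairs w ≤ 4 * u
      cross no-swap pos = let _ , _ , vxy = linkPairs>0⇒LinkEdge pos in linkPairs-cross no-swap vxy

    TripleBound : Triple n → Set
    TripleBound t = 2 * ∑₃ linkPairs t ≤ u * u + 6 * (4 * u)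

    augment-or-triple-bound : IsMatching H M → InducedK4⁻Free H → ¬ UncoveredEdge →
                              ∀ {t} → t ∈ M → Augmentable M ⊎ TripleBound t
    augment-or-triple-bound isM k4 no-edge {a , b , c} p
      with disjoint-or-cross-bounded a b | disjoint-or-cross-bounded a c | disjoint-or-cross-bounded b c
    ... | inj₁ swap | _ | _ =
      inj₁ (augment-by-swap isM p (here refl) (there (here refl)) (edge⇒≢₁₂ (matching-edge isM p)) swap)
    ... | inj₂ _ | inj₁ swap | _ =
      inj₁ (augment-by-swap isM p (here refl) (there (there (here refl))) (edge⇒≢₁₃ (matching-edge isM p)) swap)
    ... | inj₂ _ | inj₂ _ | inj₁ swap =
      inj₁ (augment-by-swap isM p (there (here refl)) (there (there (here refl))) (edge⇒≢₂₃ (matching-edge isM p)) swap)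
    ... | inj₂ ab | inj₂ ac | inj₂ bc =
      inj₂ (triple-bound _ _ _ (mantel-at (here refl)) (mantel-at (there (here refl)))
                               (mantel-at (there (there (here refl)))) ab ac bc)
      where
      mantel-at : ∀ {v} → v ∈ a ∷ b ∷ c ∷ [] → 2 * linkPairs v ≤ u * u
      mantel-at v∈t = linkPairs-mantel k4 no-edge (verts-∈ p v∈t)

    ∑codeg≡∑linkPairs : ∑[ x ∈ U ] ∑[ y ∈ U ] codeg H x y ≡ ∑[ z ∈ allFin n ] linkPairs z
    ∑codeg≡∑linkPairs = begin
      ∑[ x ∈ U ] ∑[ y ∈ U ] codeg H x y
        ≡⟨ ∑-cong U (λ {x} _ → ∑-cong U (λ {y} _ → length-filter-T? (allFin n) (edge H x y))) ⟩
      ∑[ x ∈ U ] ∑[ y ∈ U ] ∑[ z ∈ allFin n ] χ x y z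
        ≡⟨ ∑-cong U (λ {x} _ → ∑-comm U (allFin n) (χ x)) ⟩
      ∑[ x ∈ U ] ∑[ z ∈ allFin n ] ∑[ y ∈ U ] χ x y z
        ≡⟨ ∑-comm U (allFin n) _ ⟩
      ∑[ z ∈ allFin n ] ∑[ x ∈ U ] ∑[ y ∈ U ] χ x y z
        ≡⟨ ∑-cong (allFin n) (λ {z} _ → ∑-cong U (λ {x} _ → ∑-cong U (λ {y} _ → χ-rotate x y z))) ⟩
      ∑[ z ∈ allFin n ] linkPairs z ∎
      where open ≡-Reasoning

    ∑linkPairs≤ : ¬ UncoveredEdge → ∑[ z ∈ allFin n ] linkPairs z ≤ ∑ M (∑₃ linkPairs)
    ∑linkPairs≤ no-edge = ≤-trans (∑-mono-⊆ (allFin⁺ n) covered) (≤-reflexive (∑-verts M linkPairs))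
      where
      covered : ∀ {z} → z ∈ allFin n → 0 < linkPairs z → z ∈ W
      covered {z} _ pos with z ∈? W
      ... | yes z∈W = z∈W
      ... | no  z∉W = let x , y , zxy = linkPairs>0⇒LinkEdge pos in ⊥-elim (no-edge (z , x , y , z∉W , zxy))

    augment-or-bound : ∀ {p q} .{{_ : NonZero n}} → IsMatching H M → InducedK4⁻Free H → 6 * p ≤ 5 * q →
                       (∀ (x y : Fin n) → x ≢ y → (q + 6 * p) * n ≤ 6 * q * codeg H x y) →
                       Augmentable M ⊎ p * uncovered M ≤ 5 * q
    augment-or-bound {p} {q} isM k4 6p≤5q codeg-bound with uncoveredEdge?
    ... | yes edge = inj₁ (augment-by-edge isM edge)
    ... | no no-edge = map₂ bound (All.sequenceA 0ℓ (Sumₗ.applicative (Augmentable M) 0ℓ)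
                                     (All.tabulate (augment-or-triple-bound isM k4 no-edge)))
      where
      open ≤-Reasoning
      K = (q + 6 * p) * n
      X = u * u + 6 * (4 * u)
      T = ∑[ x ∈ U ] ∑[ y ∈ U ] codeg H x y
      2T≤mX : All TripleBound M → 2 * T ≤ length M * X
      2T≤mX triples = begin
        2 * T                              ≡⟨ cong (2 *_) ∑codeg≡∑linkPairs ⟩
        2 * ∑[ z ∈ allFin n ] linkPairs z  ≤⟨ *-monoʳ-≤ 2 (∑linkPairs≤ no-edge) ⟩
        2 * ∑ M (∑₃ linkPairs)             ≡⟨ *-distribˡ-∑ 2 M _ ⟩
        ∑[ t ∈ M ] (2 * ∑₃ linkPairs t)    ≤⟨ ∑-mono M (All.lookup triples) ⟩
        ∑[ t ∈ M ] X                       ≡⟨ ∑-const M X ⟩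
        length M * X                       ∎
      lower : u * (u * K) ≤ 6 * q * T + u * K
      lower = begin
        u * (u * K)
          ≤⟨ ∑∑-lower-bound (λ x y → 6 * q * codeg H x y) U-unique codeg-bound ⟩
        ∑[ x ∈ U ] ∑[ y ∈ U ] (6 * q * codeg H x y) + u * K
          ≡⟨ cong (_+ u * K) (sym (trans (*-distribˡ-∑ (6 * q) U _)
                                         (∑-cong U (λ {x} _ → *-distribˡ-∑ (6 * q) U (codeg H x))))) ⟩
        6 * q * T + u * K ∎
      bound : All TripleBound M → p * u ≤ 5 * q
      bound triples = uncovered-bound {n} {length M} {u} {p} {q} {T} 6p≤5q (3*length≤n isM) (2T≤mX triples) lower

theorem3p1 : (p q : ℕ) → 0 < p → 0 < q →
    ∃[ n₀ ] ∀ n → n₀ ≤ n → (H : ThreeGraph n) → InducedK4⁻Free H →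
    (∀ (x y : Fin n) → x ≢ y → (q + 6 * p) * n ≤ 6 * q * codeg H x y) →
    ∃[ M ] (IsMatching H M × p * uncovered M ≤ 5 * q)
-- The counting needs no largeness of n: two vertices only serve to read off γ ≤ 5/6 from the
-- codegree condition.
theorem3p1 p q _ _ = 2 , large
  where
  large : ∀ n → 2 ≤ n → (H : ThreeGraph n) → InducedK4⁻Free H →
          (∀ (x y : Fin n) → x ≢ y → (q + 6 * p) * n ≤ 6 * q * codeg H x y) →
          ∃[ M ] (IsMatching H M × p * uncovered M ≤ 5 * q)
  large zero          ()
  large (suc zero)    (s≤s ())
  large n@(suc (suc _)) _ H k4 codeg-bound =
    bounded-improvement length n (λ {M} isM → ≤-trans (m≤n*m (length M) 3) (3*length≤n H isM))
      (λ {M} isM → Uncovered.augment-or-bound H M {p} {q} isM k4 6p≤5q codeg-bound) ([] , [])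
    where
    6p≤5q : 6 * p ≤ 5 * q
    6p≤5q = density≤5/6 H {p} {q} fzero (fsuc fzero) (codeg-bound fzero (fsuc fzero) (λ ()))
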